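{- Let $f(x)\in\mathbb Z[x]$ be nonzero, and suppose $f(x)=-2x+x^2g(x)$ with $g(x)\in\mathbb Z[x]$. Then $\frac1x+\frac1{f(x)}+\frac1{f(f(x))}\in\mathbb Q(x)$ never has a specializable continued fraction.
   Context: An element of $\mathbb Q(x)$ is said to have a specializable continued fraction if it can be written as a finite continued fraction $[b_0,b_1,\dots,b_m]=b_0+\cfrac{1}{b_1+\cfrac{1}{\ddots+\cfrac1{b_m}}}$ with all partial quotients $b_i\in\mathbb Z[x]$ (zero or negative partial quotients allowed). -}

module Defs where

open import Data.Integer using (ℤ; +_; -_) renaming (_+_ to _+ℤ_; _*_ to _*ℤ_)
open import Data.List using (List; []; _∷_; map)
open import Data.List.Relation.Unary.All using (All)
open import Data.Product using (Σ; _×_; ∃-syntax)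
open import Relation.Binary.PropositionalEquality using (_≡_)
open import Relation.Nullary using (¬_)

-- Polynomials in ℤ[x] as coefficient lists, lowest degree first.
-- Trailing zeros are allowed; equality is taken up to trailing zeros.
Poly : Set
Poly = List ℤ

infixl 6 _+ₚ_ _-ₚ_
infixl 7 _*ₚ_

_+ₚ_ : Poly → Poly → Poly
[] +ₚ q = q
(a ∷ p) +ₚ [] = a ∷ p
(a ∷ p) +ₚ (b ∷ q) = (a +ℤ b) ∷ (p +ₚ q)

negₚ : Poly → Poly
negₚ = map -_

_-ₚ_ : Poly → Poly → Poly
p -ₚ q = p +ₚ negₚ q

scaleₚ : ℤ → Poly → Poly
scaleₚ a = map (a *ℤ_)

_*ₚ_ : Poly → Poly → Poly
[] *ₚ q = []
(a ∷ p) *ₚ q = scaleₚ a q +ₚ (+ 0 ∷ (p *ₚ q))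

IsZero : Poly → Set
IsZero p = All (_≡ + 0) p

infix 4 _≈ₚ_
_≈ₚ_ : Poly → Poly → Set
p ≈ₚ q = IsZero (p -ₚ q)

constₚ : ℤ → Poly
constₚ a = a ∷ []

oneₚ : Poly
oneₚ = constₚ (+ 1)

X : Poly
X = + 0 ∷ + 1 ∷ []

_∘ₚ_ : Poly → Poly → Poly
[] ∘ₚ q = []
(a ∷ p) ∘ₚ q = constₚ a +ₚ (q *ₚ (p ∘ₚ q))

-- CFEval bs n d : the finite continued fraction [b₀,…,bₘ] (bs nonempty)
-- is well defined in ℚ(x) and equals n/d (with d ≠ 0).
-- [b] = b/1 ;  [b, rest] = b + 1/[rest], defined only when [rest] is
-- defined and nonzero; if [rest] = n/d (n ≠ 0) then b + d/n = (b·n + d)/n.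
data CFEval : List Poly → Poly → Poly → Set where
  cf-single : ∀ b → CFEval (b ∷ []) b oneₚ
  cf-cons   : ∀ b {bs n d} → CFEval bs n d → ¬ IsZero n →
              CFEval (b ∷ bs) (b *ₚ n +ₚ d) n

HasSpecializableCF : Poly → Poly → Set
HasSpecializableCF N D =
  ∃[ bs ] ∃[ n ] ∃[ d ] (CFEval bs n d × (n *ₚ D ≈ₚ N *ₚ d))

-- 1/x + 1/f + 1/f(f) written as a single fraction
-- (f·f(f) + x·f(f) + x·f) / (x·f·f(f)).
targetNum : Poly → Poly
targetNum f = f *ₚ (f ∘ₚ f) +ₚ X *ₚ (f ∘ₚ f) +ₚ X *ₚ f

targetDen : Poly → Poly
targetDen f = X *ₚ f *ₚ (f ∘ₚ f)

{-# OPTIONS --safe #-}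
module Submission where

-- Putting x = 0 in a continued fraction with partial quotients in ℤ[x] gives one over ℤ,
-- so if [b₀,…,bₘ] = n/d then n(0) and d(0) are coprime. For f = -2x + O(x²) we have
-- f(f(x)) = 4x + O(x²), so the target is N/D with N = -6x² + O(x³) and D = -8x³ + O(x⁴).
-- In nD = Nd the x² coefficients give d(0) = 0, hence n(0) = ±1, and then the x³
-- coefficients give -8 n(0) = -6 d'(0), so -6 would divide -8.

open import Defs
open import Data.Integer using (ℤ; +_; -[1+_])
open import Data.List using (List; []; _∷_)
open import Data.Product using (∃-syntax)
open import Relation.Nullary using (¬_)

open import Data.Nat using (ℕ; zero; suc; _<_; z≤n; s≤s)
import Data.Nat as ℕ
import Data.Nat.Properties as ℕₚ
open import Data.Integer using (_+_; _*_; -_; _-_)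
open import Data.Integer.Properties
  using ( +-identityˡ; +-identityʳ; *-identityˡ; *-zeroʳ; *-comm; *-assoc
        ; i-j≡0⇒i≡j; i*j≡0⇒i≡0∨j≡0)
open import Data.Integer.Divisibility.Signed using (_∣_; divides; _∣?_)
open import Data.Integer.Tactic.RingSolver using (solve-∀)
open import Data.List.Relation.Unary.All using (_∷_)
open import Data.Product using (_,_)
open import Data.Sum using (inj₁; inj₂)
open import Relation.Binary.PropositionalEquality
open import Relation.Nullary using (contradiction)
open import Relation.Nullary.Decidable using (toWitnessFalse)
open ≡-Reasoning

coeff : Poly → ℕ → ℤ
coeff []      _       = + 0
coeff (a ∷ p) zero    = a
coeff (a ∷ p) (suc k) = coeff p k

coeff-+ₚ : ∀ p q k → coeff (p +ₚ q) k ≡ coeff p k + coeff q k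
coeff-+ₚ []      q       k       = sym (+-identityˡ _)
coeff-+ₚ (a ∷ p) []      k       = sym (+-identityʳ _)
coeff-+ₚ (a ∷ p) (b ∷ q) zero    = refl
coeff-+ₚ (a ∷ p) (b ∷ q) (suc k) = coeff-+ₚ p q k

coeff-negₚ : ∀ q k → coeff (negₚ q) k ≡ - coeff q k
coeff-negₚ []      k       = refl
coeff-negₚ (b ∷ q) zero    = refl
coeff-negₚ (b ∷ q) (suc k) = coeff-negₚ q k

coeff-scaleₚ : ∀ a q k → coeff (scaleₚ a q) k ≡ a * coeff q k
coeff-scaleₚ a []      k       = sym (*-zeroʳ a)
coeff-scaleₚ a (b ∷ q) zero    = refl
coeff-scaleₚ a (b ∷ q) (suc k) = coeff-scaleₚ a q k

IsZero⇒coeff≡0 : ∀ {p} → IsZero p → ∀ k → coeff p k ≡ + 0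
IsZero⇒coeff≡0 {[]}    _        k       = refl
IsZero⇒coeff≡0 {a ∷ p} (a≡0 ∷ _) zero    = a≡0
IsZero⇒coeff≡0 {a ∷ p} (_ ∷ p≡0) (suc k) = IsZero⇒coeff≡0 p≡0 k

≈ₚ⇒coeff≡ : ∀ p q → p ≈ₚ q → ∀ k → coeff p k ≡ coeff q k
≈ₚ⇒coeff≡ p q p≈q k = i-j≡0⇒i≡j _ _ (begin
  coeff p k - coeff q k        ≡⟨ cong (_+_ (coeff p k)) (coeff-negₚ q k) ⟨
  coeff p k + coeff (negₚ q) k ≡⟨ coeff-+ₚ p (negₚ q) k ⟨
  coeff (p -ₚ q) k             ≡⟨ IsZero⇒coeff≡0 p≈q k ⟩
  + 0                          ∎)

cauchy : (ℕ → ℤ) → (ℕ → ℤ) → ℕ → ℤ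
cauchy a b zero    = a 0 * b 0
cauchy a b (suc k) = a 0 * b (suc k) + cauchy (λ i → a (suc i)) b k

cauchy-zeroˡ : ∀ b k → cauchy (λ _ → + 0) b k ≡ + 0
cauchy-zeroˡ b zero    = refl
cauchy-zeroˡ b (suc k) = trans (+-identityˡ _) (cauchy-zeroˡ b k)

coeff-*ₚ : ∀ p q k → coeff (p *ₚ q) k ≡ cauchy (coeff p) (coeff q) k
coeff-*ₚ []      q k = sym (cauchy-zeroˡ (coeff q) k)
coeff-*ₚ (a ∷ p) q k = begin
  coeff (scaleₚ a q +ₚ (+ 0 ∷ p *ₚ q)) k
    ≡⟨ coeff-+ₚ (scaleₚ a q) _ k ⟩
  coeff (scaleₚ a q) k + coeff (+ 0 ∷ p *ₚ q) k
    ≡⟨ cong (_+ coeff (+ 0 ∷ p *ₚ q) k) (coeff-scaleₚ a q k) ⟩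
  a * coeff q k + coeff (+ 0 ∷ p *ₚ q) k
    ≡⟨ shifted k ⟩
  cauchy (coeff (a ∷ p)) (coeff q) k
    ∎
  where
  shifted : ∀ k → a * coeff q k + coeff (+ 0 ∷ p *ₚ q) k ≡ cauchy (coeff (a ∷ p)) (coeff q) k
  shifted zero    = +-identityʳ _
  shifted (suc k) = cong (_+_ (a * coeff q (suc k))) (coeff-*ₚ p q k)

VanishesBelow : ℕ → (ℕ → ℤ) → Set
VanishesBelow m a = ∀ i → i < m → a i ≡ + 0

vanishesBelow-zero : ∀ {a} → VanishesBelow 0 a
vanishesBelow-zero _ ()

vanishesBelow-one : ∀ {a} → a 0 ≡ + 0 → VanishesBelow 1 a
vanishesBelow-one a₀≡0 zero (s≤s z≤n) = a₀≡0

cauchy-vanishesBelow : ∀ m {l a b} → VanishesBelow m a → VanishesBelow l b →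
                       VanishesBelow (m ℕ.+ l) (cauchy a b)
cauchy-vanishesBelow zero    {a = a} {b} _ b-vb = right b-vb
  where
  right : ∀ {l a} → VanishesBelow l b → VanishesBelow l (cauchy a b)
  right {a = a} b-vb zero    0<l   = trans (cong (a 0 *_) (b-vb 0 0<l)) (*-zeroʳ (a 0))
  right {a = a} b-vb (suc i) i+1<l =
    cong₂ _+_ (trans (cong (a 0 *_) (b-vb (suc i) i+1<l)) (*-zeroʳ (a 0)))
              (right b-vb i (ℕₚ.<⇒≤ i+1<l))
cauchy-vanishesBelow (suc m) {b = b} a-vb b-vb zero    _ = cong (_* b 0) (a-vb 0 (s≤s z≤n))
cauchy-vanishesBelow (suc m) {b = b} a-vb b-vb (suc i) (s≤s i<m+l) =
  cong₂ _+_ (cong (_* b (suc i)) (a-vb 0 (s≤s z≤n)))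
            (cauchy-vanishesBelow m (λ j j<m → a-vb (suc j) (s≤s j<m)) b-vb i i<m+l)

cauchy-lowest : ∀ m {l a b} → VanishesBelow m a → VanishesBelow l b →
                cauchy a b (m ℕ.+ l) ≡ a m * b l
cauchy-lowest zero {zero}          _ _    = refl
cauchy-lowest zero {suc l} {a} {b} _ b-vb = begin
  a 0 * b (suc l) + cauchy (λ i → a (suc i)) b l
    ≡⟨ cong (_+_ (a 0 * b (suc l))) (cauchy-vanishesBelow 0 vanishesBelow-zero b-vb l (ℕₚ.n<1+n l)) ⟩
  a 0 * b (suc l) + + 0
    ≡⟨ +-identityʳ _ ⟩
  a 0 * b (suc l) ∎
cauchy-lowest (suc m) {l} {a} {b} a-vb b-vb = begin
  a 0 * b (suc m ℕ.+ l) + cauchy (λ i → a (suc i)) b (m ℕ.+ l)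
    ≡⟨ cong₂ _+_ (cong (_* b (suc m ℕ.+ l)) (a-vb 0 (s≤s z≤n)))
                 (cauchy-lowest m (λ j j<m → a-vb (suc j) (s≤s j<m)) b-vb) ⟩
  + 0 + a (suc m) * b l
    ≡⟨ +-identityˡ _ ⟩
  a (suc m) * b l ∎

*ₚ-vanishesBelow : ∀ m {l} p q → VanishesBelow m (coeff p) → VanishesBelow l (coeff q) →
                   VanishesBelow (m ℕ.+ l) (coeff (p *ₚ q))
*ₚ-vanishesBelow m p q p-vb q-vb i i<m+l =
  trans (coeff-*ₚ p q i) (cauchy-vanishesBelow m p-vb q-vb i i<m+l)

coeff-*ₚ-lowest : ∀ m {l} p q → VanishesBelow m (coeff p) → VanishesBelow l (coeff q) →
                  coeff (p *ₚ q) (m ℕ.+ l) ≡ coeff p m * coeff q l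
coeff-*ₚ-lowest m p q p-vb q-vb = trans (coeff-*ₚ p q _) (cauchy-lowest m p-vb q-vb)

+ₚ-vanishesBelow : ∀ {m} p q → VanishesBelow m (coeff p) → VanishesBelow m (coeff q) →
                   VanishesBelow m (coeff (p +ₚ q))
+ₚ-vanishesBelow p q p-vb q-vb i i<m =
  trans (coeff-+ₚ p q i) (cong₂ _+_ (p-vb i i<m) (q-vb i i<m))

coeff-∘ₚ-zero : ∀ p {q} → coeff q 0 ≡ + 0 → coeff (p ∘ₚ q) 0 ≡ coeff p 0
coeff-∘ₚ-zero []      _     = refl
coeff-∘ₚ-zero (a ∷ p) {q} q₀≡0 = begin
  coeff (constₚ a +ₚ q *ₚ (p ∘ₚ q)) 0 ≡⟨ coeff-+ₚ (constₚ a) (q *ₚ (p ∘ₚ q)) 0 ⟩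
  a + coeff (q *ₚ (p ∘ₚ q)) 0         ≡⟨ cong (_+_ a) (coeff-*ₚ q _ 0) ⟩
  a + coeff q 0 * coeff (p ∘ₚ q) 0    ≡⟨ cong (λ c → a + c * coeff (p ∘ₚ q) 0) q₀≡0 ⟩
  a + + 0                             ≡⟨ +-identityʳ a ⟩
  a                                   ∎

coeff-∘ₚ-one : ∀ p {q} → coeff q 0 ≡ + 0 → coeff (p ∘ₚ q) 1 ≡ coeff p 1 * coeff q 1
coeff-∘ₚ-one []      _     = refl
coeff-∘ₚ-one (a ∷ p) {q} q₀≡0 = begin
  coeff (constₚ a +ₚ q *ₚ (p ∘ₚ q)) 1
    ≡⟨ coeff-+ₚ (constₚ a) (q *ₚ (p ∘ₚ q)) 1 ⟩
  + 0 + coeff (q *ₚ (p ∘ₚ q)) 1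
    ≡⟨ +-identityˡ _ ⟩
  coeff (q *ₚ (p ∘ₚ q)) 1
    ≡⟨ coeff-*ₚ q _ 1 ⟩
  coeff q 0 * coeff (p ∘ₚ q) 1 + coeff q 1 * coeff (p ∘ₚ q) 0
    ≡⟨ cong₂ (λ c e → c * coeff (p ∘ₚ q) 1 + coeff q 1 * e) q₀≡0 (coeff-∘ₚ-zero p q₀≡0) ⟩
  + 0 + coeff q 1 * coeff p 0
    ≡⟨ +-identityˡ _ ⟩
  coeff q 1 * coeff p 0
    ≡⟨ *-comm (coeff q 1) (coeff p 0) ⟩
  coeff p 0 * coeff q 1
    ∎

Unimodular : ℤ → ℤ → Set
Unimodular a b = ∃[ u ] ∃[ v ] u * a + v * b ≡ + 1

unimodular-step : ∀ c {a b} → Unimodular a b → Unimodular (c * a + b) a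
unimodular-step c {a} {b} (u , v , ua+vb≡1) = v , u - v * c , trans (regroup u v c a b) ua+vb≡1
  where
  regroup : ∀ u v c a b → v * (c * a + b) + (u - v * c) * a ≡ u * a + v * b
  regroup = solve-∀

CFEval⇒unimodular : ∀ {bs n d} → CFEval bs n d → Unimodular (coeff n 0) (coeff d 0)
CFEval⇒unimodular (cf-single b) = + 0 , + 1 , refl
CFEval⇒unimodular (cf-cons b {n = n} {d} ev _) =
  subst (λ c → Unimodular c (coeff n 0)) (sym constant-term)
        (unimodular-step (coeff b 0) (CFEval⇒unimodular ev))
  where
  constant-term : coeff (b *ₚ n +ₚ d) 0 ≡ coeff b 0 * coeff n 0 + coeff d 0
  constant-term = trans (coeff-+ₚ (b *ₚ n) d 0) (cong (_+ coeff d 0) (coeff-*ₚ b n 0))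

lowest-coefficient-∣ : ∀ k n d N D → Unimodular (coeff n 0) (coeff d 0) → n *ₚ D ≈ₚ N *ₚ d →
                        VanishesBelow k (coeff N) → VanishesBelow (suc k) (coeff D) →
                        coeff N k ≢ + 0 → coeff N k ∣ coeff D (suc k)
lowest-coefficient-∣ k n d N D (u , v , bezout) nD≈Nd N-vb D-vb ν≢0 =
  divides (u * coeff d 1) δ≡u*d₁*ν
  where
  ν δ : ℤ
  ν = coeff N k
  δ = coeff D (suc k)

  ν*d₀≡0 : ν * coeff d 0 ≡ + 0
  ν*d₀≡0 = begin
    ν * coeff d 0            ≡⟨ coeff-*ₚ-lowest k N d N-vb vanishesBelow-zero ⟨
    coeff (N *ₚ d) (k ℕ.+ 0) ≡⟨ cong (coeff (N *ₚ d)) (ℕₚ.+-identityʳ k) ⟩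
    coeff (N *ₚ d) k         ≡⟨ ≈ₚ⇒coeff≡ (n *ₚ D) (N *ₚ d) nD≈Nd k ⟨
    coeff (n *ₚ D) k         ≡⟨ *ₚ-vanishesBelow 0 n D vanishesBelow-zero D-vb k (ℕₚ.n<1+n k) ⟩
    + 0                      ∎

  d₀≡0 : coeff d 0 ≡ + 0
  d₀≡0 with i*j≡0⇒i≡0∨j≡0 ν ν*d₀≡0
  ... | inj₁ ν≡0 = contradiction ν≡0 ν≢0
  ... | inj₂ d₀≡0 = d₀≡0

  v*d₀≡0 : v * coeff d 0 ≡ + 0
  v*d₀≡0 = trans (cong (v *_) d₀≡0) (*-zeroʳ v)

  u*n₀≡1 : u * coeff n 0 ≡ + 1
  u*n₀≡1 = begin
    u * coeff n 0                 ≡⟨ +-identityʳ _ ⟨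
    u * coeff n 0 + + 0           ≡⟨ cong (_+_ (u * coeff n 0)) v*d₀≡0 ⟨
    u * coeff n 0 + v * coeff d 0 ≡⟨ bezout ⟩
    + 1                           ∎

  n₀*δ≡ν*d₁ : coeff n 0 * δ ≡ ν * coeff d 1
  n₀*δ≡ν*d₁ = begin
    coeff n 0 * δ            ≡⟨ coeff-*ₚ-lowest 0 n D vanishesBelow-zero D-vb ⟨
    coeff (n *ₚ D) (suc k)   ≡⟨ ≈ₚ⇒coeff≡ (n *ₚ D) (N *ₚ d) nD≈Nd (suc k) ⟩
    coeff (N *ₚ d) (suc k)   ≡⟨ cong (coeff (N *ₚ d)) (ℕₚ.+-comm 1 k) ⟩
    coeff (N *ₚ d) (k ℕ.+ 1) ≡⟨ coeff-*ₚ-lowest k N d N-vb (vanishesBelow-one d₀≡0) ⟩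
    ν * coeff d 1            ∎

  rearrange : ∀ u ν e → u * (ν * e) ≡ u * e * ν
  rearrange = solve-∀

  δ≡u*d₁*ν : δ ≡ u * coeff d 1 * ν
  δ≡u*d₁*ν = begin
    δ                     ≡⟨ *-identityˡ δ ⟨
    + 1 * δ               ≡⟨ cong (_* δ) u*n₀≡1 ⟨
    u * coeff n 0 * δ     ≡⟨ *-assoc u (coeff n 0) δ ⟩
    u * (coeff n 0 * δ)   ≡⟨ cong (u *_) n₀*δ≡ν*d₁ ⟩
    u * (ν * coeff d 1)   ≡⟨ rearrange u ν (coeff d 1) ⟩
    u * coeff d 1 * ν     ∎

X-vanishesBelow : VanishesBelow 1 (coeff X)
X-vanishesBelow = vanishesBelow-one refl

coeff-X*ₚ : ∀ {l} p → VanishesBelow l (coeff p) → coeff (X *ₚ p) (suc l) ≡ coeff p l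
coeff-X*ₚ p p-vb = trans (coeff-*ₚ-lowest 1 X p X-vanishesBelow p-vb) (*-identityˡ _)

module _ {f : Poly} {a : ℤ} (f₀ : coeff f 0 ≡ + 0) (f₁ : coeff f 1 ≡ a) where

  private
    f-vb : VanishesBelow 1 (coeff f)
    f-vb = vanishesBelow-one f₀

    f∘f-vb : VanishesBelow 1 (coeff (f ∘ₚ f))
    f∘f-vb = vanishesBelow-one (trans (coeff-∘ₚ-zero f f₀) f₀)

    coeff-f∘f-1 : coeff (f ∘ₚ f) 1 ≡ a * a
    coeff-f∘f-1 = trans (coeff-∘ₚ-one f f₀) (cong₂ _*_ f₁ f₁)

    x*f-vb : VanishesBelow 2 (coeff (X *ₚ f))
    x*f-vb = *ₚ-vanishesBelow 1 X f X-vanishesBelow f-vb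

  targetDen-vanishesBelow : VanishesBelow 3 (coeff (targetDen f))
  targetDen-vanishesBelow = *ₚ-vanishesBelow 2 (X *ₚ f) (f ∘ₚ f) x*f-vb f∘f-vb

  coeff-targetDen-3 : coeff (targetDen f) 3 ≡ a * (a * a)
  coeff-targetDen-3 = begin
    coeff (X *ₚ f *ₚ (f ∘ₚ f)) 3        ≡⟨ coeff-*ₚ-lowest 2 (X *ₚ f) (f ∘ₚ f) x*f-vb f∘f-vb ⟩
    coeff (X *ₚ f) 2 * coeff (f ∘ₚ f) 1 ≡⟨ cong₂ _*_ (trans (coeff-X*ₚ f f-vb) f₁) coeff-f∘f-1 ⟩
    a * (a * a)                         ∎

  targetNum-vanishesBelow : VanishesBelow 2 (coeff (targetNum f))
  targetNum-vanishesBelow =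
    +ₚ-vanishesBelow (f *ₚ (f ∘ₚ f) +ₚ X *ₚ (f ∘ₚ f)) (X *ₚ f)
      (+ₚ-vanishesBelow (f *ₚ (f ∘ₚ f)) (X *ₚ (f ∘ₚ f))
        (*ₚ-vanishesBelow 1 f (f ∘ₚ f) f-vb f∘f-vb)
        (*ₚ-vanishesBelow 1 X (f ∘ₚ f) X-vanishesBelow f∘f-vb))
      x*f-vb

  coeff-targetNum-2 : coeff (targetNum f) 2 ≡ a * (a * a) + a * a + a
  coeff-targetNum-2 = begin
    coeff (f *ₚ (f ∘ₚ f) +ₚ X *ₚ (f ∘ₚ f) +ₚ X *ₚ f) 2
      ≡⟨ coeff-+ₚ (f *ₚ (f ∘ₚ f) +ₚ X *ₚ (f ∘ₚ f)) (X *ₚ f) 2 ⟩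
    coeff (f *ₚ (f ∘ₚ f) +ₚ X *ₚ (f ∘ₚ f)) 2 + coeff (X *ₚ f) 2
      ≡⟨ cong (_+ coeff (X *ₚ f) 2) (coeff-+ₚ (f *ₚ (f ∘ₚ f)) (X *ₚ (f ∘ₚ f)) 2) ⟩
    coeff (f *ₚ (f ∘ₚ f)) 2 + coeff (X *ₚ (f ∘ₚ f)) 2 + coeff (X *ₚ f) 2
      ≡⟨ cong₂ _+_ (cong₂ _+_ (coeff-*ₚ-lowest 1 f (f ∘ₚ f) f-vb f∘f-vb) (coeff-X*ₚ (f ∘ₚ f) f∘f-vb))
                   (coeff-X*ₚ f f-vb) ⟩
    coeff f 1 * coeff (f ∘ₚ f) 1 + coeff (f ∘ₚ f) 1 + coeff f 1
      ≡⟨ cong₂ (λ b c → b * c + c + b) f₁ coeff-f∘f-1 ⟩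
    a * (a * a) + a * a + a
      ∎

  specializable⇒divides : a * (a * a) + a * a + a ≢ + 0 →
                          HasSpecializableCF (targetNum f) (targetDen f) →
                          a * (a * a) + a * a + a ∣ a * (a * a)
  specializable⇒divides ν≢0 (_ , n , d , ev , nD≈Nd) =
    subst₂ _∣_ coeff-targetNum-2 coeff-targetDen-3
      (lowest-coefficient-∣ 2 n d (targetNum f) (targetDen f) (CFEval⇒unimodular ev) nD≈Nd
        targetNum-vanishesBelow targetDen-vanishesBelow
        (λ ν≡0 → ν≢0 (trans (sym coeff-targetNum-2) ν≡0)))

coeff-+ₚ-x²-low : ∀ p g k → k < 2 → coeff (p +ₚ X *ₚ X *ₚ g) k ≡ coeff p k
coeff-+ₚ-x²-low p g k k<2 = begin
  coeff (p +ₚ X *ₚ X *ₚ g) k         ≡⟨ coeff-+ₚ p (X *ₚ X *ₚ g) k ⟩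
  coeff p k + coeff (X *ₚ X *ₚ g) k  ≡⟨ cong (_+_ (coeff p k)) (x²g-vb k k<2) ⟩
  coeff p k + + 0                    ≡⟨ +-identityʳ _ ⟩
  coeff p k                          ∎
  where
  x²g-vb : VanishesBelow 2 (coeff (X *ₚ X *ₚ g))
  x²g-vb = *ₚ-vanishesBelow 2 (X *ₚ X) g
             (*ₚ-vanishesBelow 1 X X X-vanishesBelow X-vanishesBelow) vanishesBelow-zero

lemma7p6 : (f : Poly) → ¬ IsZero f →
    ∃[ g ] (f ≈ₚ constₚ -[1+ 1 ] *ₚ X +ₚ X *ₚ X *ₚ g) →
    ¬ HasSpecializableCF (targetNum f) (targetDen f)
lemma7p6 f _ (g , f≈-2x+x²g) specializable =
  -6∤-8 (specializable⇒divides {f = f} f₀ f₁ (λ ()) specializable)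
  where
  -2x : Poly
  -2x = constₚ -[1+ 1 ] *ₚ X

  f₀ : coeff f 0 ≡ + 0
  f₀ = trans (≈ₚ⇒coeff≡ f _ f≈-2x+x²g 0) (coeff-+ₚ-x²-low -2x g 0 (s≤s z≤n))

  f₁ : coeff f 1 ≡ -[1+ 1 ]
  f₁ = trans (≈ₚ⇒coeff≡ f _ f≈-2x+x²g 1) (coeff-+ₚ-x²-low -2x g 1 (s≤s (s≤s z≤n)))

  -6∤-8 : ¬ (-[1+ 5 ] ∣ -[1+ 7 ])
  -6∤-8 = toWitnessFalse {a? = -[1+ 5 ] ∣? -[1+ 7 ]} _
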